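{- Let $r\geq 3$, let $H$ be an $r$-vertex multigraph with $h$ edges such that $w_H(e)\geq 1$ for every pair $e$ of distinct vertices of $H$, and let $k$ be an integer with $h\leq k\leq h+\lfloor r/2\rfloor-1$. Then there is $\delta_0>0$ such that for every $0<\delta\le\delta_0$ there is $n_0$ such that for all $n\ge n_0$: if $G$ is an $n$-vertex simply $k$-colored multigraph with no multicolored copy of $H$ and $\delta(G)\geq (1-\delta)(h-1)(n-1)$, then $w_G(e)\leq h-1$ for every pair $e$ of distinct vertices of $G$.
   Context: A multigraph is loopless with possibly parallel edges; $w_G(uv)$ is the multiplicity of the pair $uv$ (possibly $0$), $e(H)$ counts edges with multiplicity, and degrees (hence the minimum degree $\delta(G)$) count edges with multiplicity. A simple $k$-coloring of $G$ is a decomposition of its edge multiset as a disjoint sum of $k$ simple graphs on $V(G)$ (colors). A copy of the multigraph $H$ in $G$ is multicolored if all its edges (with multiplicity) receive pairwise distinct colors, i.e. there is an injection $\varphi:V(H)\to V(G)$ and distinct colors assigned to all edges of $H$, each copy of $uv$ getting a color $i$ such that $\varphi(u)\varphi(v)$ is an edge of color $i$.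
   Formalization: The parameters $\delta_0$ and $\delta$ are taken in ℚ. -}

module Defs where

open import Data.Nat as ℕ using (ℕ; zero; suc; _+_)
open import Data.Fin as Fin using (Fin; zero; suc)
open import Data.Bool using (Bool; true; false; if_then_else_)
open import Data.Integer using (+_)
open import Data.Rational as ℚ using (ℚ; _/_)
open import Data.Product using (_×_)
open import Relation.Binary.PropositionalEquality using (_≡_)
open import Function.Definitions using (Injective)

∑ : (n : ℕ) → (Fin n → ℕ) → ℕ
∑ zero    f = 0
∑ (suc n) f = f zero + ∑ n (λ i → f (suc i))

ℕ→ℚ : ℕ → ℚ
ℕ→ℚ n = + n / 1

record Multigraph (r : ℕ) : Set where
  field
    w        : Fin r → Fin r → ℕ
    w-sym    : ∀ u v → w u v ≡ w v u
    loopless : ∀ u → w u u ≡ 0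

edges : ∀ {r} → Multigraph r → ℕ
edges {r} H = ∑ r (λ u → ∑ r (λ v → if Fin.toℕ u ℕ.<ᵇ Fin.toℕ v then Multigraph.w H u v else 0))

-- A simply k-colored multigraph on Fin n: k colour classes, each a simple graph
-- (symmetric, irreflexive adjacency). The multigraph G is the disjoint sum of them.
record SimplyColored (n k : ℕ) : Set where
  field
    adj       : Fin k → Fin n → Fin n → Bool
    adj-sym   : ∀ i u v → adj i u v ≡ adj i v u
    adj-irr   : ∀ i u → adj i u u ≡ false

module _ {n k : ℕ} (G : SimplyColored n k) where
  open SimplyColored G

  wG : Fin n → Fin n → ℕ
  wG u v = ∑ k (λ i → if adj i u v then 1 else 0)

  deg : Fin n → ℕ
  deg v = ∑ n (λ u → wG v u)

record MulticoloredCopy {r n k : ℕ} (H : Multigraph r) (G : SimplyColored n k) : Set where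
  open Multigraph H
  open SimplyColored G
  field
    φ       : Fin r → Fin n
    φ-inj   : Injective _≡_ _≡_ φ
    col     : Fin r → Fin r → ℕ → Fin k
    col-ok  : ∀ u v t → u Fin.< v → t ℕ.< w u v → adj (col u v t) (φ u) (φ v) ≡ true
    col-inj : ∀ u v t u′ v′ t′ → u Fin.< v → t ℕ.< w u v → u′ Fin.< v′ → t′ ℕ.< w u′ v′ →
              col u v t ≡ col u′ v′ t′ → (u ≡ u′) × (v ≡ v′) × (t ≡ t′)

module Submission where

open import Defs
open import Data.Nat using (ℕ; _≤_; _+_; _∸_; _*_; _/_)
open import Data.Fin using (Fin)
open import Data.Rational as ℚ using (ℚ; 0ℚ; 1ℚ)
open import Data.Product using (Σ; _×_)
open import Relation.Binary.PropositionalEquality using (_≢_)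
open import Relation.Nullary using (¬_)

open import Data.Bool using (Bool; true; false; if_then_else_; _∧_; _∨_)
import Data.Bool.Properties as Boolₚ
open import Data.Empty using (⊥-elim)
open import Data.Fin as Fin using (zero; suc; toℕ; _≟_)
import Data.Fin.Properties as Finₚ
import Data.Integer as ℤ
import Data.Integer.Properties as ℤₚ
open import Data.Nat as ℕ using (zero; suc; _<_; _<ᵇ_; _≤ᵇ_; _≤?_; _<?_; z≤n; s≤s)
import Data.Nat.Coprimality as Coprime
open import Data.Nat.DivMod using (m/n*n≤m; m≥n⇒m/n>0)
open import Data.Nat.Properties hiding (_≟_)
open import Algebra.Properties.CommutativeSemigroup +-commutativeSemigroup
  using () renaming (interchange to +-interchange)
open import Data.Nat.Solver using (module +-*-Solver)
open import Data.Product using (_,_; ∃-syntax)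
import Data.Rational.Properties as ℚₚ
open import Data.Rational.Solver using () renaming (module +-*-Solver to ℚ-Solver)
open import Data.Sum using (_⊎_; inj₁; inj₂)
open import Function using (_∘_; Equivalence)
open import Relation.Binary.PropositionalEquality
  using (_≡_; refl; sym; trans; cong; cong₂; subst; subst₂; module ≡-Reasoning)
open import Relation.Nullary using (yes; no; does; contradiction)
open import Relation.Nullary.Decidable using (_×-dec_; ¬?; dec-true)
open import Relation.Nullary.Reflects using (ofʸ; ofⁿ)

-- Suppose w_G(uv) ≥ h.  Put u and v first and embed the other vertices of H one at a
-- time: averaging the minimum degree bound over the j vertices already placed yields,
-- for n large, a new vertex joined to them by at least j(h − 1) edges.  Writing
-- g(a, b) = w_G(φa, φb) ≤ k, every vertex b then has back-degree ∑_{a<b} g(a, b) ≥ b(h − 1),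
-- strictly for b = 1.  For t ≤ h − 1, each of the N pairs with g ≤ t costs k − t in these
-- inequalities, so (k − t) N < (k − h + 1) · #pairs, and 2(k − h + 1) ≤ r gives k − t ≤ #pairs
-- as soon as N > 0; together N ≤ #pairs − h + t.  Since every pair of H carries an edge, at
-- most t edges of H lie on pairs with at most t colours, and this Hall-type condition lets
-- the edges of H be coloured greedily with distinct colours, each copy of ab taking the
-- colour of an edge φ(a)φ(b).

∑-cong : ∀ n {f g : Fin n → ℕ} → (∀ i → f i ≡ g i) → ∑ n f ≡ ∑ n g
∑-cong zero    f≗g = refl
∑-cong (suc n) f≗g = cong₂ _+_ (f≗g zero) (∑-cong n (f≗g ∘ suc))

∑-mono : ∀ n {f g : Fin n → ℕ} → (∀ i → f i ≤ g i) → ∑ n f ≤ ∑ n g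
∑-mono zero    f≤g = z≤n
∑-mono (suc n) f≤g = +-mono-≤ (f≤g zero) (∑-mono n (f≤g ∘ suc))

∑-mono-< : ∀ n {f g : Fin n → ℕ} → (∀ i → f i ≤ g i) → ∀ i → f i < g i → ∑ n f < ∑ n g
∑-mono-< (suc n) f≤g zero    f<g = +-mono-<-≤ f<g (∑-mono n (f≤g ∘ suc))
∑-mono-< (suc n) f≤g (suc i) f<g = +-mono-≤-< (f≤g zero) (∑-mono-< n (f≤g ∘ suc) i f<g)

term≤∑ : ∀ n (f : Fin n → ℕ) i → f i ≤ ∑ n f
term≤∑ (suc n) f zero    = m≤m+n _ _
term≤∑ (suc n) f (suc i) = ≤-trans (term≤∑ n (f ∘ suc) i) (m≤n+m _ _)

∑-const : ∀ n c → ∑ n (λ _ → c) ≡ n * c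
∑-const zero    c = refl
∑-const (suc n) c = cong (c +_) (∑-const n c)

∑-zero : ∀ n → ∑ n (λ _ → 0) ≡ 0
∑-zero n = trans (∑-const n 0) (*-zeroʳ n)

∑-distrib-+ : ∀ n (f g : Fin n → ℕ) → ∑ n (λ i → f i + g i) ≡ ∑ n f + ∑ n g
∑-distrib-+ zero    f g = refl
∑-distrib-+ (suc n) f g =
  trans (cong (f zero + g zero +_) (∑-distrib-+ n (f ∘ suc) (g ∘ suc)))
        (+-interchange (f zero) (g zero) _ _)

*-distribˡ-∑ : ∀ n c (f : Fin n → ℕ) → c * ∑ n f ≡ ∑ n (λ i → c * f i)
*-distribˡ-∑ zero    c f = *-zeroʳ c
*-distribˡ-∑ (suc n) c f =
  trans (*-distribˡ-+ c (f zero) _) (cong (c * f zero +_) (*-distribˡ-∑ n c (f ∘ suc)))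

∑-comm : ∀ m n (f : Fin m → Fin n → ℕ) →
         ∑ m (λ i → ∑ n (f i)) ≡ ∑ n (λ j → ∑ m (λ i → f i j))
∑-comm zero    n f = sym (∑-zero n)
∑-comm (suc m) n f = trans (cong (∑ n (f zero) +_) (∑-comm m n (f ∘ suc)))
                           (sym (∑-distrib-+ n (f zero) _))

∑-toℕ : ∀ n → 2 * ∑ n toℕ + n ≡ n * n
∑-toℕ zero    = refl
∑-toℕ (suc n) = begin
  2 * ∑ n (λ i → 1 + toℕ i) + suc n  ≡⟨ cong (λ x → 2 * x + suc n) (∑-distrib-+ n _ toℕ) ⟩
  2 * (∑ n (λ _ → 1) + S) + suc n     ≡⟨ cong (λ x → 2 * (x + S) + suc n) (∑-const n 1) ⟩
  2 * (n * 1 + S) + suc n             ≡⟨ cong (λ x → 2 * (x + S) + suc n) (*-identityʳ n) ⟩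
  2 * (n + S) + suc n                 ≡⟨ solve 2 (λ n S → con 2 :* (n :+ S) :+ (con 1 :+ n)
                                                     := (con 2 :* S :+ n) :+ (con 1 :+ con 2 :* n)) refl n S ⟩
  (2 * S + n) + (1 + 2 * n)           ≡⟨ cong (_+ (1 + 2 * n)) (∑-toℕ n) ⟩
  n * n + (1 + 2 * n)                 ≡⟨ solve 1 (λ n → n :* n :+ (con 1 :+ con 2 :* n)
                                                     := (con 1 :+ n) :* (con 1 :+ n)) refl n ⟩
  suc n * suc n                       ∎
  where
  open ≡-Reasoning
  open +-*-Solver using (solve; _:+_; _:*_; _:=_; con)
  S : ℕ
  S = ∑ n toℕ

if-mono : ∀ p {m n} → m ≤ n → (if p then m else 0) ≤ (if p then n else 0)
if-mono true  m≤n = m≤n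
if-mono false _   = z≤n

∑-if : ∀ n p (f : Fin n → ℕ) → ∑ n (λ i → if p then f i else 0) ≡ (if p then ∑ n f else 0)
∑-if n true  f = refl
∑-if n false f = ∑-zero n

∑-≟ : ∀ n (x : Fin n) c → ∑ n (λ i → if does (i ≟ x) then c else 0) ≡ c
∑-≟ (suc n) zero    c = trans (cong (c +_) (∑-zero n)) (+-identityʳ c)
∑-≟ (suc n) (suc x) c = ∑-≟ n x c

count : ∀ {n} → (Fin n → Bool) → ℕ
count {n} P = ∑ n (λ i → if P i then 1 else 0)

count≤ : ∀ {n} (P : Fin n → Bool) → count P ≤ n
count≤ {zero}  P = z≤n
count≤ {suc n} P with P zero
... | true  = s≤s (count≤ (P ∘ suc))
... | false = m≤n⇒m≤1+n (count≤ (P ∘ suc))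

∑-if-const : ∀ n (P : Fin n → Bool) c → ∑ n (λ i → if P i then c else 0) ≡ count P * c
∑-if-const zero    P c = refl
∑-if-const (suc n) P c with P zero
... | true  = cong (c +_) (∑-if-const n (P ∘ suc) c)
... | false = ∑-if-const n (P ∘ suc) c

count-<ᵇ : ∀ {n j} → j ≤ n → count {n} (λ i → toℕ i <ᵇ j) ≡ j
count-<ᵇ {zero}  {zero}  _         = refl
count-<ᵇ {suc n} {zero}  _         = ∑-zero n
count-<ᵇ {suc n} {suc j} (s≤s j≤n) = cong suc (count-<ᵇ j≤n)

fresh : ∀ {k} (P U : Fin k → Bool) → count U < count P → ∃[ c ] (P c ≡ true × U c ≡ false)
fresh {k} P U U<P with Finₚ.any? (λ c → (P c Boolₚ.≟ true) ×-dec (U c Boolₚ.≟ false))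
... | yes found = found
... | no  none  = contradiction (∑-mono k P⊆U) (<⇒≱ U<P)
  where
  P⊆U : ∀ c → (if P c then 1 else 0) ≤ (if U c then 1 else 0)
  P⊆U c with P c in Pc | U c in Uc
  ... | false | _     = z≤n
  ... | true  | true  = ≤-refl
  ... | true  | false = contradiction (c , Pc , Uc) none

insert : ∀ {k} → Fin k → (Fin k → Bool) → Fin k → Bool
insert c U x = does (x ≟ c) ∨ U x

insert-self : ∀ {k} (c : Fin k) U → insert c U c ≡ true
insert-self c U = cong (_∨ U c) (dec-true (c ≟ c) refl)

insert-⊇ : ∀ {k} (c : Fin k) U {x} → U x ≡ true → insert c U x ≡ true
insert-⊇ c U {x} Ux = trans (cong (does (x ≟ c) ∨_) Ux) (Boolₚ.∨-zeroʳ (does (x ≟ c)))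

count-insert : ∀ {k} (c : Fin k) U → count (insert c U) ≤ suc (count U)
count-insert {k} c U = begin
  count (insert c U)
    ≤⟨ ∑-mono k (λ x → if-∨ (does (x ≟ c)) (U x)) ⟩
  ∑ k (λ x → (if does (x ≟ c) then 1 else 0) + (if U x then 1 else 0))
    ≡⟨ ∑-distrib-+ k _ _ ⟩
  ∑ k (λ x → if does (x ≟ c) then 1 else 0) + count U
    ≡⟨ cong (_+ count U) (∑-≟ k c 1) ⟩
  suc (count U) ∎
  where
  open ≤-Reasoning
  if-∨ : ∀ p q → (if p ∨ q then 1 else 0) ≤ (if p then 1 else 0) + (if q then 1 else 0)
  if-∨ true  q = s≤s z≤n
  if-∨ false q = ≤-refl

∑∑ : ∀ {r} → (Fin r → Fin r → ℕ) → ℕ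
∑∑ {r} f = ∑ r (λ a → ∑ r (f a))

∑∑-cong : ∀ {r} {f g : Fin r → Fin r → ℕ} → (∀ a b → f a b ≡ g a b) → ∑∑ f ≡ ∑∑ g
∑∑-cong {r} f≗g = ∑-cong r (λ a → ∑-cong r (f≗g a))

∑∑-mono : ∀ {r} {f g : Fin r → Fin r → ℕ} → (∀ a b → f a b ≤ g a b) → ∑∑ f ≤ ∑∑ g
∑∑-mono {r} f≤g = ∑-mono r (λ a → ∑-mono r (f≤g a))

∑∑-zero : ∀ {r} → ∑∑ {r} (λ _ _ → 0) ≡ 0
∑∑-zero {r} = trans (∑-cong r (λ _ → ∑-zero r)) (∑-zero r)

∑∑-distrib-+ : ∀ {r} (f g : Fin r → Fin r → ℕ) →
               ∑∑ (λ a b → f a b + g a b) ≡ ∑∑ f + ∑∑ g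
∑∑-distrib-+ {r} f g = trans (∑-cong r (λ a → ∑-distrib-+ r (f a) (g a))) (∑-distrib-+ r _ _)

term≤∑∑ : ∀ {r} (f : Fin r → Fin r → ℕ) a b → f a b ≤ ∑∑ f
term≤∑∑ {r} f a b = ≤-trans (term≤∑ r (f a) b) (term≤∑ r (λ a → ∑ r (f a)) a)

∑∑-≟ : ∀ {r} (a₀ b₀ : Fin r) c →
       ∑∑ (λ a b → if does (a ≟ a₀) ∧ does (b ≟ b₀) then c else 0) ≡ c
∑∑-≟ {r} a₀ b₀ c = trans (∑-cong r row) (∑-≟ r a₀ c)
  where
  row : ∀ a → ∑ r (λ b → if does (a ≟ a₀) ∧ does (b ≟ b₀) then c else 0) ≡
              (if does (a ≟ a₀) then c else 0)
  row a with does (a ≟ a₀)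
  ... | true  = ∑-≟ r b₀ c
  ... | false = ∑-zero r

-- c₀ only fills the copies that are not demanded.
module ListEdgeColouring {r k : ℕ} (C : Fin r → Fin r → Fin k → Bool) (c₀ : Fin k) where

  record Colouring (d : Fin r → Fin r → ℕ) : Set where
    field
      colour     : Fin r → Fin r → ℕ → Fin k
      used       : Fin k → Bool
      count-used : count used ≤ ∑∑ d
      allowed    : ∀ a b t → t < d a b → C a b (colour a b t) ≡ true
      marked     : ∀ a b t → t < d a b → used (colour a b t) ≡ true
      injective  : ∀ a b t a′ b′ t′ → t < d a b → t′ < d a′ b′ →
                   colour a b t ≡ colour a′ b′ t′ → a ≡ a′ × b ≡ b′ × t ≡ t′

  listSize : Fin r → Fin r → ℕ
  listSize a b = count (C a b)

  shortDemand : (Fin r → Fin r → ℕ) → ℕ → ℕ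
  shortDemand d t = ∑∑ (λ a b → if listSize a b ≤ᵇ t then d a b else 0)

  emptyColouring : ∀ d → ∑∑ d ≡ 0 → Colouring d
  emptyColouring d total≡0 = record
    { colour     = λ _ _ _ → c₀
    ; used       = λ _ → false
    ; count-used = subst (_≤ ∑∑ d) (sym (∑-zero k)) z≤n
    ; allowed    = λ a b t t<d → ⊥-elim (no-copy a b t t<d)
    ; marked     = λ a b t t<d → ⊥-elim (no-copy a b t t<d)
    ; injective  = λ a b t _ _ _ t<d _ _ → ⊥-elim (no-copy a b t t<d)
    }
    where
    no-copy : ∀ a b t → ¬ t < d a b
    no-copy a b t t<d with ≤-trans t<d (subst (d a b ≤_) total≡0 (term≤∑∑ d a b))
    ... | ()

  longRequest : ∀ d {D} → ∑∑ d ≡ suc D → shortDemand d D ≤ D →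
                ∃[ a ] ∃[ b ] (1 ≤ d a b × suc D ≤ listSize a b)
  longRequest d {D} total short
    with Finₚ.any? (λ a → Finₚ.any? (λ b → (1 ≤? d a b) ×-dec (suc D ≤? listSize a b)))
  ... | yes found = found
  ... | no  none  = contradiction (subst (_≤ D) total (≤-trans (∑∑-mono all-short) short)) (n≮n D)
    where
    all-short : ∀ a b → d a b ≤ (if listSize a b ≤ᵇ D then d a b else 0)
    all-short a b with listSize a b ≤ᵇ D | ≤ᵇ-reflects-≤ (listSize a b) D
    ... | true  | _ = ≤-refl
    ... | false | ofⁿ long with d a b in d≡
    ...   | zero  = z≤n
    ...   | suc _ = contradiction (a , b , subst (1 ≤_) (sym d≡) (s≤s z≤n) , ≰⇒> long) none

  module Decrement (d : Fin r → Fin r → ℕ) (a₀ b₀ : Fin r) where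

    d⁻ : Fin r → Fin r → ℕ
    d⁻ a b with a ≟ a₀ | b ≟ b₀
    ... | yes _ | yes _ = d a b ∸ 1
    ... | _     | _     = d a b

    d⁻≤d : ∀ a b → d⁻ a b ≤ d a b
    d⁻≤d a b with a ≟ a₀ | b ≟ b₀
    ... | yes _ | yes _ = m∸n≤m (d a b) 1
    ... | yes _ | no  _ = ≤-refl
    ... | no  _ | _     = ≤-refl

    ∑∑-d⁻ : 1 ≤ d a₀ b₀ → ∑∑ d ≡ suc (∑∑ d⁻)
    ∑∑-d⁻ d₀≥1 = begin
      ∑∑ d                           ≡⟨ ∑∑-cong split ⟩
      ∑∑ (λ a b → d⁻ a b + at₀ a b)  ≡⟨ ∑∑-distrib-+ d⁻ at₀ ⟩
      ∑∑ d⁻ + ∑∑ at₀                 ≡⟨ cong (∑∑ d⁻ +_) (∑∑-≟ a₀ b₀ 1) ⟩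
      ∑∑ d⁻ + 1                      ≡⟨ +-comm (∑∑ d⁻) 1 ⟩
      suc (∑∑ d⁻)                    ∎
      where
      open ≡-Reasoning
      at₀ : Fin r → Fin r → ℕ
      at₀ a b = if does (a ≟ a₀) ∧ does (b ≟ b₀) then 1 else 0
      split : ∀ a b → d a b ≡ d⁻ a b + at₀ a b
      split a b with a ≟ a₀ | b ≟ b₀
      ... | yes refl | yes refl = sym (m∸n+n≡m d₀≥1)
      ... | yes _    | no  _    = sym (+-identityʳ (d a b))
      ... | no  _    | _        = sym (+-identityʳ (d a b))

    copy-split : ∀ a b t → t < d a b → t < d⁻ a b ⊎ ((a ≡ a₀ × b ≡ b₀) × t ≡ d⁻ a b)
    copy-split a b t t<d with a ≟ a₀ | b ≟ b₀
    ... | yes a≡a₀ | yes b≡b₀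
      with m<1+n⇒m<n∨m≡n (subst (t <_) (sym (m+[n∸m]≡n (≤-trans (s≤s z≤n) t<d))) t<d)
    ...   | inj₁ t<d⁻ = inj₁ t<d⁻
    ...   | inj₂ t≡d⁻ = inj₂ ((a≡a₀ , b≡b₀) , t≡d⁻)
    copy-split a b t t<d | yes _ | no _ = inj₁ t<d
    copy-split a b t t<d | no _  | _    = inj₁ t<d

    module _ (K : Colouring d⁻) (c : Fin k) (c-allowed : C a₀ b₀ c ≡ true)
             (c-unused : Colouring.used K c ≡ false) where
      private module K = Colouring K

      colour : Fin r → Fin r → ℕ → Fin k
      colour a b t with a ≟ a₀ | b ≟ b₀ | t ℕ.≟ d⁻ a b
      ... | yes _ | yes _ | yes _ = c
      ... | _     | _     | _     = K.colour a b t

      colour-new : colour a₀ b₀ (d⁻ a₀ b₀) ≡ c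
      colour-new with a₀ ≟ a₀ | b₀ ≟ b₀ | d⁻ a₀ b₀ ℕ.≟ d⁻ a₀ b₀
      ... | yes _ | yes _ | yes _ = refl
      ... | no ¬p | _     | _     = contradiction refl ¬p
      ... | yes _ | no ¬p | _     = contradiction refl ¬p
      ... | yes _ | yes _ | no ¬p = contradiction refl ¬p

      colour-old : ∀ a b t → t < d⁻ a b → colour a b t ≡ K.colour a b t
      colour-old a b t t<d⁻ with a ≟ a₀ | b ≟ b₀ | t ℕ.≟ d⁻ a b
      ... | yes _ | yes _ | yes refl = contradiction t<d⁻ (n≮n t)
      ... | yes _ | yes _ | no  _    = refl
      ... | yes _ | no  _ | _        = refl
      ... | no  _ | _     | _        = refl

      new≢old : ∀ a b t → t < d⁻ a b → c ≢ K.colour a b t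
      new≢old a b t t<d⁻ c≡ with trans (sym c-unused) (trans (cong K.used c≡) (K.marked a b t t<d⁻))
      ... | ()

      allowed : ∀ a b t → t < d a b → C a b (colour a b t) ≡ true
      allowed a b t t<d with copy-split a b t t<d
      ... | inj₁ t<d⁻                   = trans (cong (C a b) (colour-old a b t t<d⁻)) (K.allowed a b t t<d⁻)
      ... | inj₂ ((refl , refl) , refl) = trans (cong (C a₀ b₀) colour-new) c-allowed

      marked : ∀ a b t → t < d a b → insert c K.used (colour a b t) ≡ true
      marked a b t t<d with copy-split a b t t<d
      ... | inj₁ t<d⁻ =
        insert-⊇ c K.used (subst (λ x → K.used x ≡ true) (sym (colour-old a b t t<d⁻))
                                 (K.marked a b t t<d⁻))
      ... | inj₂ ((refl , refl) , refl) =
        subst (λ x → insert c K.used x ≡ true) (sym colour-new) (insert-self c K.used)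

      injective : ∀ a b t a′ b′ t′ → t < d a b → t′ < d a′ b′ →
                  colour a b t ≡ colour a′ b′ t′ → a ≡ a′ × b ≡ b′ × t ≡ t′
      injective a b t a′ b′ t′ t<d t′<d same with copy-split a b t t<d | copy-split a′ b′ t′ t′<d
      ... | inj₁ t<d⁻ | inj₁ t′<d⁻ =
        K.injective a b t a′ b′ t′ t<d⁻ t′<d⁻
          (trans (sym (colour-old a b t t<d⁻)) (trans same (colour-old a′ b′ t′ t′<d⁻)))
      ... | inj₁ t<d⁻ | inj₂ ((refl , refl) , refl) =
        ⊥-elim (new≢old a b t t<d⁻
                  (trans (sym colour-new) (trans (sym same) (colour-old a b t t<d⁻))))
      ... | inj₂ ((refl , refl) , refl) | inj₁ t′<d⁻ =
        ⊥-elim (new≢old a′ b′ t′ t′<d⁻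
                  (trans (sym colour-new) (trans same (colour-old a′ b′ t′ t′<d⁻))))
      ... | inj₂ ((refl , refl) , refl) | inj₂ ((refl , refl) , refl) = refl , refl , refl

      extended : 1 ≤ d a₀ b₀ → Colouring d
      extended d₀≥1 = record
        { colour     = colour
        ; used       = insert c K.used
        ; count-used = subst (count (insert c K.used) ≤_) (sym (∑∑-d⁻ d₀≥1))
                             (≤-trans (count-insert c K.used) (s≤s K.count-used))
        ; allowed    = allowed
        ; marked     = marked
        ; injective  = injective
        }

    extend : 1 ≤ d a₀ b₀ → suc (∑∑ d⁻) ≤ listSize a₀ b₀ → Colouring d⁻ → Colouring d
    extend d₀≥1 long K
      with fresh (C a₀ b₀) (Colouring.used K) (≤-trans (s≤s (Colouring.count-used K)) long)
    ... | c , c-allowed , c-unused = extended K c c-allowed c-unused d₀≥1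

  -- The hypothesis at t = D − 1 (D the total demand) provides a pair whose list is at
  -- least as long as D: colour all other copies first, then one copy of that pair.
  colouring : ∀ d → (∀ t → shortDemand d t ≤ t) → Colouring d
  colouring d few = go (∑∑ d) d refl few
    where
    go : ∀ D d → ∑∑ d ≡ D → (∀ t → shortDemand d t ≤ t) → Colouring d
    go zero    d total few = emptyColouring d total
    go (suc D) d total few with longRequest d total (few D)
    ... | a₀ , b₀ , d₀≥1 , long =
      extend d₀≥1 (subst (_≤ listSize a₀ b₀) (trans (sym total) (∑∑-d⁻ d₀≥1)) long)
             (go D d⁻ (suc-injective (trans (sym (∑∑-d⁻ d₀≥1)) total)) few⁻)
      where
      open Decrement d a₀ b₀
      few⁻ : ∀ t → shortDemand d⁻ t ≤ t
      few⁻ t = ≤-trans (∑∑-mono (λ a b → if-mono (listSize a b ≤ᵇ t) (d⁻≤d a b))) (few t)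

onPairs : ∀ {r} → (Fin r → Fin r → ℕ) → Fin r → Fin r → ℕ
onPairs f a b = if toℕ a <ᵇ toℕ b then f a b else 0

onPairs-< : ∀ {r} (f : Fin r → Fin r → ℕ) {a b} → toℕ a < toℕ b → onPairs f a b ≡ f a b
onPairs-< f a<b rewrite Equivalence.to Boolₚ.T-≡ (<⇒<ᵇ a<b) = refl

backDegree : ∀ {r} → (Fin r → Fin r → ℕ) → Fin r → ℕ
backDegree {r} f b = ∑ r (λ a → onPairs f a b)

∑-backDegree : ∀ {r} (f : Fin r → Fin r → ℕ) → ∑ r (backDegree f) ≡ ∑∑ (onPairs f)
∑-backDegree {r} f = ∑-comm r r (λ b a → onPairs f a b)

backDegree-1 : ∀ {r} (b : Fin r) → backDegree (λ _ _ → 1) b ≡ toℕ b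
backDegree-1 b = count-<ᵇ (<⇒≤ (Finₚ.toℕ<n b))

*toℕ≤∑toℕ : ∀ {r s} → 2 * s ≤ r → (b : Fin r) → s * toℕ b ≤ ∑ r toℕ
*toℕ≤∑toℕ {r} {s} 2s≤r b = *-cancelˡ-≤ 2 (+-cancelʳ-≤ r _ _ (begin
  2 * (s * toℕ b) + r  ≡⟨ cong (_+ r) (*-assoc 2 s (toℕ b)) ⟨
  2 * s * toℕ b + r    ≤⟨ +-monoˡ-≤ r (*-monoˡ-≤ (toℕ b) 2s≤r) ⟩
  r * toℕ b + r        ≡⟨ +-comm (r * toℕ b) r ⟩
  r + r * toℕ b        ≡⟨ *-suc r (toℕ b) ⟨
  r * suc (toℕ b)      ≤⟨ *-monoʳ-≤ r (Finₚ.toℕ<n b) ⟩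
  r * r                ≡⟨ ∑-toℕ r ⟨
  2 * ∑ r toℕ + r      ∎))
  where open ≤-Reasoning

excess-arith : ∀ j s N S → j + s ≤ S → 1 + (j + s) * N ≤ s * S → N + j < S
excess-arith j s N S j+s≤S total with N + j <? S
... | yes N+j<S = N+j<S
... | no  N+j≮S = contradiction total (<⇒≱ (s≤s (begin
  s * S          ≤⟨ *-monoʳ-≤ s S≤N+j ⟩
  s * (N + j)    ≡⟨ *-distribˡ-+ s N j ⟩
  s * N + s * j  ≤⟨ +-monoʳ-≤ (s * N) (*-monoˡ-≤ j s≤N) ⟩
  s * N + N * j  ≡⟨ solve 3 (λ j s N → s :* N :+ N :* j := (j :+ s) :* N) refl j s N ⟩
  (j + s) * N    ∎)))
  where
  open ≤-Reasoning
  open +-*-Solver using (solve; _:+_; _:*_; _:=_)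
  S≤N+j : S ≤ N + j
  S≤N+j = ≮⇒≥ N+j≮S
  s≤N : s ≤ N
  s≤N = +-cancelʳ-≤ j s N (subst (_≤ N + j) (+-comm j s) (≤-trans j+s≤S S≤N+j))

module ShortPairs {r : ℕ} (g : Fin r → Fin r → ℕ) (h′ s : ℕ)
  (g≤h′+s : ∀ a b → g a b ≤ h′ + s) (2s≤r : 2 * s ≤ r)
  (backDegree≥ : ∀ b → h′ * toℕ b ≤ backDegree g b)
  (b₁ : Fin r) (backDegree₁> : h′ * toℕ b₁ < backDegree g b₁) where

  k : ℕ
  k = h′ + s

  short long : ℕ → Fin r → Fin r → ℕ
  short t a b = if g a b ≤ᵇ t then 1 else 0
  long  t a b = if g a b ≤ᵇ t then 0 else 1

  shortPairs : ℕ → ℕ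
  shortPairs t = ∑ r (backDegree (short t))

  pair-excess : ∀ {t} → t ≤ k → ∀ a b →
                onPairs g a b + (k ∸ t) * onPairs (short t) a b ≤ onPairs (λ _ _ → k) a b
  pair-excess {t} t≤k a b with toℕ a <ᵇ toℕ b
  ... | false = ≤-reflexive (*-zeroʳ (k ∸ t))
  ... | true with g a b ≤ᵇ t | ≤ᵇ-reflects-≤ (g a b) t
  ...   | true  | ofʸ g≤t = begin
    g a b + (k ∸ t) * 1  ≤⟨ +-mono-≤ g≤t (≤-reflexive (*-identityʳ (k ∸ t))) ⟩
    t + (k ∸ t)          ≡⟨ m+[n∸m]≡n t≤k ⟩
    k                    ∎
    where open ≤-Reasoning
  ...   | false | _ =
    ≤-trans (≤-reflexive (trans (cong (g a b +_) (*-zeroʳ (k ∸ t))) (+-identityʳ (g a b)))) (g≤h′+s a b)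

  vertex-excess : ∀ {t} → t ≤ k → ∀ b →
                  backDegree g b + (k ∸ t) * backDegree (short t) b ≤ k * toℕ b
  vertex-excess {t} t≤k b = begin
    backDegree g b + (k ∸ t) * backDegree (short t) b
      ≡⟨ cong (backDegree g b +_) (*-distribˡ-∑ r (k ∸ t) _) ⟩
    backDegree g b + ∑ r (λ a → (k ∸ t) * onPairs (short t) a b)
      ≡⟨ ∑-distrib-+ r _ _ ⟨
    ∑ r (λ a → onPairs g a b + (k ∸ t) * onPairs (short t) a b)
      ≤⟨ ∑-mono r (λ a → pair-excess t≤k a b) ⟩
    backDegree (λ _ _ → k) b
      ≡⟨ ∑-if-const r (λ a → toℕ a <ᵇ toℕ b) k ⟩
    backDegree (λ _ _ → 1) b * k
      ≡⟨ cong (_* k) (backDegree-1 b) ⟩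
    toℕ b * k
      ≡⟨ *-comm (toℕ b) k ⟩
    k * toℕ b ∎
    where open ≤-Reasoning

  short-excess : ∀ {t} → t ≤ k → ∀ b → (k ∸ t) * backDegree (short t) b ≤ s * toℕ b
  short-excess {t} t≤k b = +-cancelˡ-≤ (h′ * toℕ b) _ _ (begin
    h′ * toℕ b + (k ∸ t) * backDegree (short t) b     ≤⟨ +-monoˡ-≤ _ (backDegree≥ b) ⟩
    backDegree g b + (k ∸ t) * backDegree (short t) b ≤⟨ vertex-excess t≤k b ⟩
    k * toℕ b                                         ≡⟨ *-distribʳ-+ (toℕ b) h′ s ⟩
    h′ * toℕ b + s * toℕ b                            ∎)
    where open ≤-Reasoning

  total-excess : ∀ {t} → t ≤ k → 1 + (k ∸ t) * shortPairs t ≤ s * ∑ r toℕ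
  total-excess {t} t≤k = +-cancelˡ-≤ (h′ * ∑ r toℕ) _ _ (begin
    h′ * ∑ r toℕ + (1 + (k ∸ t) * shortPairs t)   ≡⟨ +-suc _ _ ⟩
    suc (h′ * ∑ r toℕ) + (k ∸ t) * shortPairs t   ≤⟨ +-monoˡ-≤ _ backDegree-total ⟩
    ∑ r (backDegree g) + (k ∸ t) * shortPairs t
      ≡⟨ cong (∑ r (backDegree g) +_) (*-distribˡ-∑ r (k ∸ t) _) ⟩
    ∑ r (backDegree g) + ∑ r (λ b → (k ∸ t) * backDegree (short t) b)
      ≡⟨ ∑-distrib-+ r _ _ ⟨
    ∑ r (λ b → backDegree g b + (k ∸ t) * backDegree (short t) b)
      ≤⟨ ∑-mono r (vertex-excess t≤k) ⟩
    ∑ r (λ b → k * toℕ b)                         ≡⟨ *-distribˡ-∑ r k toℕ ⟨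
    k * ∑ r toℕ                                   ≡⟨ *-distribʳ-+ (∑ r toℕ) h′ s ⟩
    h′ * ∑ r toℕ + s * ∑ r toℕ                    ∎)
    where
    open ≤-Reasoning
    backDegree-total : h′ * ∑ r toℕ < ∑ r (backDegree g)
    backDegree-total = subst (_< ∑ r (backDegree g)) (sym (*-distribˡ-∑ r h′ toℕ))
                             (∑-mono-< r backDegree≥ b₁ backDegree₁>)

  excess≤pairs : ∀ {t a b} → t ≤ k → toℕ a < toℕ b → g a b ≤ t → k ∸ t ≤ ∑ r toℕ
  excess≤pairs {t} {a} {b} t≤k a<b g≤t = begin
    k ∸ t                              ≡⟨ *-identityʳ (k ∸ t) ⟨
    (k ∸ t) * 1                        ≤⟨ *-monoʳ-≤ (k ∸ t) short-ab≤ ⟩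
    (k ∸ t) * backDegree (short t) b   ≤⟨ short-excess t≤k b ⟩
    s * toℕ b                          ≤⟨ *toℕ≤∑toℕ {s = s} 2s≤r b ⟩
    ∑ r toℕ                            ∎
    where
    open ≤-Reasoning
    short-ab : onPairs (short t) a b ≡ 1
    short-ab rewrite onPairs-< (short t) a<b | Equivalence.to Boolₚ.T-≡ (≤⇒≤ᵇ g≤t) = refl
    short-ab≤ : 1 ≤ backDegree (short t) b
    short-ab≤ = subst (_≤ backDegree (short t) b) short-ab (term≤∑ r (λ a → onPairs (short t) a b) a)

  few-short-pairs : ∀ {t a b} → toℕ a < toℕ b → g a b ≤ t → shortPairs t + suc h′ ≤ t + ∑ r toℕ
  few-short-pairs {t} a<b g≤t with t ≤? h′
  ... | no t≰h′ = begin
    shortPairs t + suc h′            ≤⟨ +-mono-≤ (∑-mono r (λ b → ∑-mono r (λ a → short≤1 a b)))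
                                                 (≰⇒> t≰h′) ⟩
    ∑ r (backDegree (λ _ _ → 1)) + t ≡⟨ cong (_+ t) (∑-cong r backDegree-1) ⟩
    ∑ r toℕ + t                      ≡⟨ +-comm (∑ r toℕ) t ⟩
    t + ∑ r toℕ                      ∎
    where
    open ≤-Reasoning
    short≤1 : ∀ a b → onPairs (short t) a b ≤ onPairs (λ _ _ → 1) a b
    short≤1 a b = if-mono (toℕ a <ᵇ toℕ b) (indicator≤1 (g a b ≤ᵇ t))
      where
      indicator≤1 : ∀ p → (if p then 1 else 0) ≤ 1
      indicator≤1 true  = ≤-refl
      indicator≤1 false = z≤n
  ... | yes t≤h′ = begin
    shortPairs t + suc h′      ≡⟨ cong (λ x → shortPairs t + suc x) (m+[n∸m]≡n t≤h′) ⟨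
    shortPairs t + suc (t + j) ≡⟨ solve 3 (λ N t j → N :+ (con 1 :+ (t :+ j)) := t :+ (con 1 :+ (N :+ j)))
                                         refl (shortPairs t) t j ⟩
    t + suc (shortPairs t + j) ≤⟨ +-monoʳ-≤ t (excess-arith j s (shortPairs t) (∑ r toℕ)
                                    (subst (_≤ ∑ r toℕ) excess≡ (excess≤pairs t≤k a<b g≤t))
                                    (subst (λ e → 1 + e * shortPairs t ≤ s * ∑ r toℕ) excess≡
                                           (total-excess t≤k))) ⟩
    t + ∑ r toℕ                ∎
    where
    open ≤-Reasoning
    open +-*-Solver using (solve; _:+_; _:=_; con)
    j : ℕ
    j = h′ ∸ t
    t≤k : t ≤ k
    t≤k = ≤-trans t≤h′ (m≤m+n h′ s)
    excess≡ : k ∸ t ≡ j + s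
    excess≡ = +-∸-comm s t≤h′

  few-short-copies : (w : Fin r → Fin r → ℕ) → (∀ a b → toℕ a < toℕ b → 1 ≤ w a b) →
                     ∑∑ (onPairs w) ≡ suc h′ →
                     ∀ t → ∑∑ (λ a b → if g a b ≤ᵇ t then onPairs w a b else 0) ≤ t
  few-short-copies w w≥1 total t
    with Finₚ.any? (λ a → Finₚ.any? (λ b → (toℕ a <? toℕ b) ×-dec (g a b ≤? t)))
  ... | no none = ≤-trans (∑∑-mono no-short) (≤-trans (≤-reflexive (∑∑-zero {r})) z≤n)
    where
    no-short : ∀ a b → (if g a b ≤ᵇ t then onPairs w a b else 0) ≤ 0
    no-short a b
      with g a b ≤ᵇ t | ≤ᵇ-reflects-≤ (g a b) t | toℕ a <ᵇ toℕ b | <ᵇ-reflects-< (toℕ a) (toℕ b)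
    ... | false | _       | _     | _       = z≤n
    ... | true  | _       | false | _       = z≤n
    ... | true  | ofʸ g≤t | true  | ofʸ a<b = contradiction (a , b , a<b , g≤t) none
  ... | yes (a , b , a<b , g≤t) = +-cancelʳ-≤ (N + Y) X t (begin
    X + (N + Y)   ≡⟨ solve 3 (λ X N Y → X :+ (N :+ Y) := (X :+ Y) :+ N) refl X N Y ⟩
    (X + Y) + N   ≡⟨ cong (_+ N) (∑∑-distrib-+ short-copies (onPairs (long t))) ⟨
    ∑∑ (λ a b → short-copies a b + onPairs (long t) a b) + N
                  ≤⟨ +-monoˡ-≤ N (≤-trans (∑∑-mono cover) (≤-reflexive total)) ⟩
    suc h′ + N    ≡⟨ +-comm (suc h′) N ⟩
    N + suc h′    ≤⟨ few-short-pairs a<b g≤t ⟩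
    t + ∑ r toℕ   ≡⟨ cong (t +_) N+Y≡pairs ⟨
    t + (N + Y)   ∎)
    where
    open ≤-Reasoning
    open +-*-Solver using (solve; _:+_; _:=_)
    short-copies : Fin r → Fin r → ℕ
    short-copies a b = if g a b ≤ᵇ t then onPairs w a b else 0
    X Y N : ℕ
    X = ∑∑ short-copies
    Y = ∑∑ (onPairs (long t))
    N = shortPairs t
    cover : ∀ a b → short-copies a b + onPairs (long t) a b ≤ onPairs w a b
    cover a b with toℕ a <ᵇ toℕ b | <ᵇ-reflects-< (toℕ a) (toℕ b) | g a b ≤ᵇ t
    ... | false | _       | false = z≤n
    ... | false | _       | true  = z≤n
    ... | true  | _       | true  = ≤-reflexive (+-identityʳ (w a b))
    ... | true  | ofʸ a<b | false = w≥1 a b a<b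
    partition : ∀ a b → onPairs (short t) a b + onPairs (long t) a b ≡ onPairs (λ _ _ → 1) a b
    partition a b with toℕ a <ᵇ toℕ b | g a b ≤ᵇ t
    ... | false | _     = refl
    ... | true  | true  = refl
    ... | true  | false = refl
    N+Y≡pairs : N + Y ≡ ∑ r toℕ
    N+Y≡pairs = begin-equality
      N + Y
        ≡⟨ cong (_+ Y) (∑-backDegree (short t)) ⟩
      ∑∑ (onPairs (short t)) + Y
        ≡⟨ ∑∑-distrib-+ (onPairs (short t)) (onPairs (long t)) ⟨
      ∑∑ (λ a b → onPairs (short t) a b + onPairs (long t) a b)
        ≡⟨ ∑∑-cong partition ⟩
      ∑∑ {r} (onPairs (λ _ _ → 1))
        ≡⟨ ∑-backDegree {r} (λ _ _ → 1) ⟨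
      ∑ r (backDegree (λ _ _ → 1))
        ≡⟨ ∑-cong r backDegree-1 ⟩
      ∑ r toℕ ∎

averaging-arith : ∀ c W Q n′ T → c < Q → Q * (c * n′) ≤ Q * T + c * n′ →
                  T + suc n′ ≤ suc n′ * c + W → suc n′ ≤ Q * (c + W)
averaging-arith c W Q n′ T c<Q lower upper = +-cancelʳ-≤ (c * n′) _ _ (begin
  suc n′ + c * n′      ≤⟨ +-monoʳ-≤ (suc n′) (*-monoʳ-≤ c (n≤1+n n′)) ⟩
  suc n′ + c * suc n′  ≤⟨ *-monoˡ-≤ (suc n′) c<Q ⟩
  Q * suc n′           ≤⟨ +-cancelˡ-≤ (Q * (c * n′)) _ _ combined ⟩
  Q * (c + W) + c * n′ ∎)
  where
  open ≤-Reasoning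
  open +-*-Solver using (solve; _:+_; _:*_; _:=_; con)
  combined : Q * (c * n′) + Q * suc n′ ≤ Q * (c * n′) + (Q * (c + W) + c * n′)
  combined = begin
    Q * (c * n′) + Q * suc n′             ≤⟨ +-monoˡ-≤ (Q * suc n′) lower ⟩
    Q * T + c * n′ + Q * suc n′
      ≡⟨ solve 4 (λ Q T c n′ → Q :* T :+ c :* n′ :+ Q :* (con 1 :+ n′)
                              := Q :* (T :+ (con 1 :+ n′)) :+ c :* n′) refl Q T c n′ ⟩
    Q * (T + suc n′) + c * n′             ≤⟨ +-monoˡ-≤ (c * n′) (*-monoʳ-≤ Q upper) ⟩
    Q * (suc n′ * c + W) + c * n′
      ≡⟨ solve 4 (λ Q c W n′ → Q :* ((con 1 :+ n′) :* c :+ W) :+ c :* n′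
                              := Q :* (c :* n′) :+ (Q :* (c :+ W) :+ c :* n′)) refl Q c W n′ ⟩
    Q * (c * n′) + (Q * (c + W) + c * n′) ∎

module Averaging {n′ k : ℕ} (G : SimplyColored (suc n′) k) (h′ Q : ℕ)
  (deg≥ : ∀ v → Q * (h′ * n′) ≤ Q * deg G v + h′ * n′) where

  n : ℕ
  n = suc n′

  module _ {m} (xs : Fin m → Fin n) (A : Fin m → Bool) where

    weight : Fin n → ℕ
    weight y = ∑ m (λ a → if A a then wG G (xs a) y else 0)

    hits : Fin n → ℕ
    hits y = ∑ m (λ a → if A a then (if does (y ≟ xs a) then 1 else 0) else 0)

    degreeSum : ℕ
    degreeSum = ∑ m (λ a → if A a then deg G (xs a) else 0)

    Unselected : Fin n → Set
    Unselected y = ¬ (∃[ a ] (A a ≡ true × xs a ≡ y))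

    ∑-weight : ∑ n weight ≡ degreeSum
    ∑-weight = trans (∑-comm n m (λ y a → if A a then wG G (xs a) y else 0))
                     (∑-cong m (λ a → ∑-if n (A a) (wG G (xs a))))

    ∑-hits : ∑ n hits ≡ count A
    ∑-hits = trans (∑-comm n m (λ y a → if A a then (if does (y ≟ xs a) then 1 else 0) else 0))
                   (∑-cong m (λ a → trans (∑-if n (A a) (λ y → if does (y ≟ xs a) then 1 else 0))
                                          (cong (λ z → if A a then z else 0) (∑-≟ n (xs a) 1))))

    weight≤ : ∀ y → weight y ≤ count A * k
    weight≤ y = ≤-trans (∑-mono m (λ a → if-mono (A a) (count≤ (λ i → SimplyColored.adj G i (xs a) y))))
                        (≤-reflexive (∑-if-const m A k))

    hits≥1 : ∀ {y a} → A a ≡ true → xs a ≡ y → 1 ≤ hits y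
    hits≥1 {y} {a} Aa refl = subst (_≤ hits y) hit (term≤∑ m _ a)
      where
      hit : (if A a then (if does (xs a ≟ xs a) then 1 else 0) else 0) ≡ 1
      hit rewrite Aa | dec-true (xs a ≟ xs a) refl = refl

    degreeSum≥ : Q * (count A * h′ * n′) ≤ Q * degreeSum + count A * h′ * n′
    degreeSum≥ = begin
      Q * (j * h′ * n′)
        ≡⟨ solve 4 (λ Q j h′ n′ → Q :* (j :* h′ :* n′) := j :* (Q :* (h′ :* n′)))
                   refl Q j h′ n′ ⟩
      j * (Q * (h′ * n′))
        ≡⟨ ∑-if-const m A (Q * (h′ * n′)) ⟨
      ∑ m (λ a → if A a then Q * (h′ * n′) else 0)
        ≤⟨ ∑-mono m (λ a → selected-deg≥ (A a) (xs a)) ⟩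
      ∑ m (λ a → Q * (if A a then deg G (xs a) else 0) + (if A a then h′ * n′ else 0))
        ≡⟨ ∑-distrib-+ m _ _ ⟩
      ∑ m (λ a → Q * (if A a then deg G (xs a) else 0)) + ∑ m (λ a → if A a then h′ * n′ else 0)
        ≡⟨ cong₂ _+_ (*-distribˡ-∑ m Q _) (sym (∑-if-const m A (h′ * n′))) ⟨
      Q * degreeSum + j * (h′ * n′)
        ≡⟨ cong (Q * degreeSum +_) (*-assoc j h′ n′) ⟨
      Q * degreeSum + j * h′ * n′ ∎
      where
      open ≤-Reasoning
      open +-*-Solver using (solve; _:*_; _:=_)
      j : ℕ
      j = count A
      selected-deg≥ : ∀ p v → (if p then Q * (h′ * n′) else 0) ≤
                              Q * (if p then deg G v else 0) + (if p then h′ * n′ else 0)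
      selected-deg≥ true  v = deg≥ v
      selected-deg≥ false v = z≤n

    degreeSum≤ : ∀ {c W} → (∀ y → weight y + 1 ≤ c + W * hits y) → degreeSum + n ≤ n * c + W * count A
    degreeSum≤ {c} {W} light = begin
      degreeSum + n                          ≡⟨ cong (degreeSum +_) (*-identityʳ n) ⟨
      degreeSum + n * 1                      ≡⟨ cong₂ _+_ ∑-weight (∑-const n 1) ⟨
      ∑ n weight + ∑ n (λ _ → 1)             ≡⟨ ∑-distrib-+ n weight (λ _ → 1) ⟨
      ∑ n (λ y → weight y + 1)               ≤⟨ ∑-mono n light ⟩
      ∑ n (λ y → c + W * hits y)             ≡⟨ ∑-distrib-+ n (λ _ → c) (λ y → W * hits y) ⟩
      ∑ n (λ _ → c) + ∑ n (λ y → W * hits y)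
                                             ≡⟨ cong₂ _+_ (∑-const n c) (sym (*-distribˡ-∑ n W hits)) ⟩
      n * c + W * ∑ n hits                   ≡⟨ cong (λ z → n * c + W * z) ∑-hits ⟩
      n * c + W * count A                    ∎
      where open ≤-Reasoning

    heavyVertex : count A * h′ < Q → Q * (count A * h′ + (count A * k + 1) * count A) < n →
                  ∃[ y ] (Unselected y × count A * h′ ≤ weight y)
    heavyVertex c<Q big
      with Finₚ.any? (λ y → ¬? (Finₚ.any? (λ a → (A a Boolₚ.≟ true) ×-dec (xs a ≟ y)))
                            ×-dec (count A * h′ ≤? weight y))
    ... | yes found = found
    ... | no  none  =
      contradiction (averaging-arith c (W * count A) Q n′ degreeSum c<Q degreeSum≥ (degreeSum≤ {c} {W} light))
                    (<⇒≱ big)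
      where
      c W : ℕ
      c = count A * h′
      W = count A * k + 1
      light : ∀ y → weight y + 1 ≤ c + W * hits y
      light y with Finₚ.any? (λ a → (A a Boolₚ.≟ true) ×-dec (xs a ≟ y))
      ... | yes (a , Aa , xa≡y) = begin
        weight y + 1     ≤⟨ +-monoˡ-≤ 1 (weight≤ y) ⟩
        W                ≡⟨ *-identityʳ W ⟨
        W * 1            ≤⟨ *-monoʳ-≤ W (hits≥1 Aa xa≡y) ⟩
        W * hits y       ≤⟨ m≤n+m _ c ⟩
        c + W * hits y   ∎
        where open ≤-Reasoning
      ... | no unselected with c ≤? weight y
      ...   | yes heavy = contradiction (y , unselected , heavy) none
      ...   | no  ¬heavy = ≤-trans (subst (_≤ c) (+-comm 1 (weight y)) (≰⇒> ¬heavy)) (m≤m+n c _)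

module GreedyEmbedding {r′ n′ k : ℕ} (G : SimplyColored (suc n′) k) (h′ Q : ℕ)
  (deg≥ : ∀ v → Q * (h′ * n′) ≤ Q * deg G v + h′ * n′)
  (rh′<Q : suc (suc r′) * h′ < Q)
  (big : Q * (suc (suc r′) * h′ + (suc (suc r′) * k + 1) * suc (suc r′)) < suc n′)
  (u v : Fin (suc n′)) (u≢v : u ≢ v) (heavy : h′ < wG G u v) where

  open Averaging G h′ Q deg≥

  r : ℕ
  r = suc (suc r′)

  weights : (Fin r → Fin n) → Fin r → Fin r → ℕ
  weights φ a b = wG G (φ a) (φ b)

  record PartialEmbedding (j : ℕ) : Set where
    field
      φ           : Fin r → Fin n
      injective   : ∀ a b → toℕ a < j → toℕ b < j → φ a ≡ φ b → a ≡ b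
      backDegree≥ : ∀ b → toℕ b < j → h′ * toℕ b ≤ backDegree (weights φ) b
      backDegree₁ : h′ < backDegree (weights φ) (suc zero)

  backDegree-local : ∀ {φ ψ} b → (∀ a → toℕ a ≤ toℕ b → φ a ≡ ψ a) →
                     backDegree (weights φ) b ≡ backDegree (weights ψ) b
  backDegree-local {φ} {ψ} b agree = ∑-cong r same
    where
    same : ∀ a → onPairs (weights φ) a b ≡ onPairs (weights ψ) a b
    same a with toℕ a <ᵇ toℕ b | <ᵇ-reflects-< (toℕ a) (toℕ b)
    ... | false | _       = refl
    ... | true  | ofʸ a<b = cong₂ (wG G) (agree a (<⇒≤ a<b)) (agree b ≤-refl)

  start : PartialEmbedding 2
  start = record { φ = φ ; injective = injective ; backDegree≥ = backDegree≥ ; backDegree₁ = backDegree₁ }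
    where
    φ : Fin r → Fin n
    φ zero    = u
    φ (suc _) = v
    backDegree₁ : h′ < backDegree (weights φ) (suc zero)
    backDegree₁ = ≤-trans heavy (m≤m+n (wG G u v) _)
    injective : ∀ a b → toℕ a < 2 → toℕ b < 2 → φ a ≡ φ b → a ≡ b
    injective zero          zero          _ _ _   = refl
    injective zero          (suc zero)    _ _ u≡v = contradiction u≡v u≢v
    injective (suc zero)    zero          _ _ v≡u = contradiction (sym v≡u) u≢v
    injective (suc zero)    (suc zero)    _ _ _   = refl
    injective (suc (suc _)) _             (s≤s (s≤s ())) _
    injective _             (suc (suc _)) _ (s≤s (s≤s ()))
    backDegree≥ : ∀ b → toℕ b < 2 → h′ * toℕ b ≤ backDegree (weights φ) b
    backDegree≥ zero          _ = ≤-trans (≤-reflexive (*-zeroʳ h′)) z≤n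
    backDegree≥ (suc zero)    _ = ≤-trans (≤-reflexive (*-identityʳ h′)) (<⇒≤ backDegree₁)
    backDegree≥ (suc (suc _)) (s≤s (s≤s ()))

  placed : ℕ → Fin r → Bool
  placed j a = toℕ a <ᵇ j

  module Extension {j} (2≤j : 2 ≤ j) (j<r : j < r) (E : PartialEmbedding j) (y : Fin n)
    (y-new : Unselected (PartialEmbedding.φ E) (placed j) y)
    (y-heavy : count (placed j) * h′ ≤ weight (PartialEmbedding.φ E) (placed j) y) where
    open PartialEmbedding E

    φ′ : Fin r → Fin n
    φ′ a with toℕ a ℕ.≟ j
    ... | yes _ = y
    ... | no  _ = φ a

    φ′-old : ∀ a → toℕ a < j → φ a ≡ φ′ a
    φ′-old a a<j with toℕ a ℕ.≟ j
    ... | yes a≡j = contradiction a≡j (<⇒≢ a<j)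
    ... | no  _   = refl

    φ′-new : ∀ a → toℕ a ≡ j → φ′ a ≡ y
    φ′-new a a≡j with toℕ a ℕ.≟ j
    ... | yes _   = refl
    ... | no  a≢j = contradiction a≡j a≢j

    old-or-new : (a : Fin r) → toℕ a < suc j → toℕ a < j ⊎ toℕ a ≡ j
    old-or-new a a<1+j = m<1+n⇒m<n∨m≡n a<1+j

    y-unplaced : ∀ a → toℕ a < j → φ a ≢ y
    y-unplaced a a<j φa≡y = y-new (a , Equivalence.to Boolₚ.T-≡ (<⇒<ᵇ a<j) , φa≡y)

    injective′ : ∀ a b → toℕ a < suc j → toℕ b < suc j → φ′ a ≡ φ′ b → a ≡ b
    injective′ a b a≤j b≤j same with old-or-new a a≤j | old-or-new b b≤j
    ... | inj₁ a<j | inj₁ b<j =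
      injective a b a<j b<j (trans (φ′-old a a<j) (trans same (sym (φ′-old b b<j))))
    ... | inj₁ a<j | inj₂ b≡j =
      contradiction (trans (φ′-old a a<j) (trans same (φ′-new b b≡j))) (y-unplaced a a<j)
    ... | inj₂ a≡j | inj₁ b<j =
      contradiction (trans (φ′-old b b<j) (trans (sym same) (φ′-new a a≡j))) (y-unplaced b b<j)
    ... | inj₂ a≡j | inj₂ b≡j = Finₚ.toℕ-injective (trans a≡j (sym b≡j))

    backDegree-new : ∀ b → toℕ b ≡ j → backDegree (weights φ′) b ≡ weight φ (placed j) y
    backDegree-new b b≡j = ∑-cong r same
      where
      same : ∀ a → onPairs (weights φ′) a b ≡ (if placed j a then wG G (φ a) y else 0)
      same a
        with toℕ a <ᵇ toℕ b | <ᵇ-reflects-< (toℕ a) (toℕ b) | toℕ a <ᵇ j | <ᵇ-reflects-< (toℕ a) j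
      ... | true  | _       | true  | ofʸ a<j = cong₂ (wG G) (sym (φ′-old a a<j)) (φ′-new b b≡j)
      ... | false | _       | false | _       = refl
      ... | true  | ofʸ a<b | false | ofⁿ a≮j = contradiction (subst (toℕ a <_) b≡j a<b) a≮j
      ... | false | ofⁿ a≮b | true  | ofʸ a<j = contradiction (subst (toℕ a <_) (sym b≡j) a<j) a≮b

    backDegree≥′ : ∀ b → toℕ b < suc j → h′ * toℕ b ≤ backDegree (weights φ′) b
    backDegree≥′ b b≤j with old-or-new b b≤j
    ... | inj₁ b<j =
      subst (h′ * toℕ b ≤_) (backDegree-local b (λ a a≤b → φ′-old a (≤-<-trans a≤b b<j))) (backDegree≥ b b<j)
    ... | inj₂ b≡j = begin
      h′ * toℕ b                ≡⟨ cong (h′ *_) b≡j ⟩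
      h′ * j                    ≡⟨ *-comm h′ j ⟩
      j * h′                    ≡⟨ cong (_* h′) (count-<ᵇ (<⇒≤ j<r)) ⟨
      count (placed j) * h′     ≤⟨ y-heavy ⟩
      weight φ (placed j) y     ≡⟨ backDegree-new b b≡j ⟨
      backDegree (weights φ′) b ∎
      where open ≤-Reasoning

    extended : PartialEmbedding (suc j)
    extended = record
      { φ           = φ′
      ; injective   = injective′
      ; backDegree≥ = backDegree≥′
      ; backDegree₁ = subst (h′ <_) (backDegree-local (suc zero) (λ a a≤1 → φ′-old a (<-≤-trans (s≤s a≤1) 2≤j)))
                            backDegree₁
      }

  extend : ∀ {j} → 2 ≤ j → j < r → PartialEmbedding j → PartialEmbedding (suc j)
  extend {j} 2≤j j<r E with heavyVertex (PartialEmbedding.φ E) (placed j) placed-h′<Q placed-small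
    where
    j≤r : j ≤ r
    j≤r = <⇒≤ j<r
    placed-h′<Q : count (placed j) * h′ < Q
    placed-h′<Q = subst (λ x → x * h′ < Q) (sym (count-<ᵇ j≤r))
                        (≤-<-trans (*-monoˡ-≤ h′ j≤r) rh′<Q)
    placed-small : Q * (count (placed j) * h′ + (count (placed j) * k + 1) * count (placed j)) < n
    placed-small = subst (λ x → Q * (x * h′ + (x * k + 1) * x) < n) (sym (count-<ᵇ j≤r))
      (≤-<-trans (*-monoʳ-≤ Q (+-mono-≤ (*-monoˡ-≤ h′ j≤r)
                                        (*-mono-≤ (+-monoˡ-≤ 1 (*-monoˡ-≤ k j≤r)) j≤r)))
                 big)
  ... | y , y-new , y-heavy = Extension.extended 2≤j j<r E y y-new y-heavy

  partialEmbedding : ∀ i → 2 + i ≤ r → PartialEmbedding (2 + i)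
  partialEmbedding zero    _     = start
  partialEmbedding (suc i) 3+i≤r = extend (s≤s (s≤s z≤n)) 3+i≤r (partialEmbedding i (<⇒≤ 3+i≤r))

  embedding : PartialEmbedding r
  embedding = partialEmbedding r′ ≤-refl

ℕ→ℚ≡mkℚ : ∀ n → ℕ→ℚ n ≡ ℚ.mkℚ (ℤ.+ n) 0 (Coprime.sym (Coprime.1-coprimeTo n))
ℕ→ℚ≡mkℚ n = ℚₚ.normalize-coprime _

ℕ→ℚ-+ : ∀ a b → ℕ→ℚ (a + b) ≡ ℕ→ℚ a ℚ.+ ℕ→ℚ b
ℕ→ℚ-+ a b rewrite ℕ→ℚ≡mkℚ a | ℕ→ℚ≡mkℚ b =
  cong (ℚ._/ 1) (sym (cong₂ ℤ._+_ (ℤₚ.*-identityʳ (ℤ.+ a)) (ℤₚ.*-identityʳ (ℤ.+ b))))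

ℕ→ℚ-* : ∀ a b → ℕ→ℚ (a * b) ≡ ℕ→ℚ a ℚ.* ℕ→ℚ b
ℕ→ℚ-* a b rewrite ℕ→ℚ≡mkℚ a | ℕ→ℚ≡mkℚ b = cong (ℚ._/ 1) (ℤₚ.pos-* a b)

ℕ→ℚ-cancel-≤ : ∀ {a b} → ℕ→ℚ a ℚ.≤ ℕ→ℚ b → a ≤ b
ℕ→ℚ-cancel-≤ {a} {b} le rewrite ℕ→ℚ≡mkℚ a | ℕ→ℚ≡mkℚ b with le
... | ℚ.*≤* a≤b =
  ℤₚ.drop‿+≤+ (subst₂ ℤ._≤_ (ℤₚ.*-identityʳ (ℤ.+ a)) (ℤₚ.*-identityʳ (ℤ.+ b)) a≤b)

ℕ→ℚ-nonNeg : ∀ n → ℚ.NonNegative (ℕ→ℚ n)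
ℕ→ℚ-nonNeg n = ℚₚ.normalize-nonNeg n 1

ℕ→ℚ-suc-pos : ∀ q → ℚ.Positive (ℕ→ℚ (suc q))
ℕ→ℚ-suc-pos q = ℚₚ.normalize-pos (suc q) 1

1/suc : ℕ → ℚ
1/suc q = ℚ.1/_ (ℕ→ℚ (suc q)) {{ℚₚ.pos⇒nonZero (ℕ→ℚ (suc q)) {{ℕ→ℚ-suc-pos q}}}}

1/suc-pos : ∀ q → 0ℚ ℚ.< 1/suc q
1/suc-pos q = ℚₚ.positive⁻¹ _ {{ℚₚ.1/pos⇒pos (ℕ→ℚ (suc q)) {{ℕ→ℚ-suc-pos q}}}}

degree-bound : ∀ q X D {δ} → δ ℚ.≤ 1/suc q → (1ℚ ℚ.- δ) ℚ.* ℕ→ℚ X ℚ.≤ ℕ→ℚ D →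
               suc q * X ≤ suc q * D + X
degree-bound q X D {δ} δ≤ [1-δ]X≤D = ℕ→ℚ-cancel-≤ (begin
  ℕ→ℚ (suc q * X)                               ≡⟨ ℕ→ℚ-* (suc q) X ⟩
  Q ℚ.* x                                       ≡⟨ split ⟩
  Q ℚ.* ((1ℚ ℚ.- δ) ℚ.* x) ℚ.+ (Q ℚ.* δ) ℚ.* x
    ≤⟨ ℚₚ.+-mono-≤ (ℚₚ.*-monoˡ-≤-nonNeg Q [1-δ]X≤D) Qδx≤x ⟩
  Q ℚ.* ℕ→ℚ D ℚ.+ x                             ≡⟨ cong (ℚ._+ x) (ℕ→ℚ-* (suc q) D) ⟨
  ℕ→ℚ (suc q * D) ℚ.+ x                         ≡⟨ ℕ→ℚ-+ (suc q * D) X ⟨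
  ℕ→ℚ (suc q * D + X)                           ∎)
  where
  open ℚₚ.≤-Reasoning
  Q x : ℚ
  Q = ℕ→ℚ (suc q)
  x = ℕ→ℚ X
  instance
    Q-nonNeg : ℚ.NonNegative Q
    Q-nonNeg = ℕ→ℚ-nonNeg (suc q)
    x-nonNeg : ℚ.NonNegative x
    x-nonNeg = ℕ→ℚ-nonNeg X
  split : Q ℚ.* x ≡ Q ℚ.* ((1ℚ ℚ.- δ) ℚ.* x) ℚ.+ (Q ℚ.* δ) ℚ.* x
  split = solve 3 (λ Q δ x → Q :* x := Q :* ((con 1ℚ :- δ) :* x) :+ (Q :* δ) :* x) refl Q δ x
    where open ℚ-Solver using (solve; _:+_; _:*_; _:-_; _:=_; con)
  Q*1/Q≡1 : Q ℚ.* 1/suc q ≡ 1ℚ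
  Q*1/Q≡1 = ℚₚ.*-inverseʳ Q {{ℚₚ.pos⇒nonZero Q {{ℕ→ℚ-suc-pos q}}}}
  Qδx≤x : (Q ℚ.* δ) ℚ.* x ℚ.≤ x
  Qδx≤x = ℚₚ.≤-trans (ℚₚ.*-monoʳ-≤-nonNeg x (ℚₚ.*-monoˡ-≤-nonNeg Q δ≤))
                     (ℚₚ.≤-reflexive (trans (cong (ℚ._* x) Q*1/Q≡1) (ℚₚ.*-identityˡ x)))

surplus-bound : ∀ {r h k} → 2 ≤ r → 1 ≤ h → k ≤ h + (r / 2 ∸ 1) → 2 * (k ∸ (h ∸ 1)) ≤ r
surplus-bound {r} {h} {k} 2≤r 1≤h k≤ = begin
  2 * (k ∸ (h ∸ 1))  ≤⟨ *-monoʳ-≤ 2 (m≤n+o⇒m∸n≤o k (h ∸ 1) (subst (k ≤_) regroup k≤)) ⟩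
  2 * (r / 2)        ≡⟨ *-comm 2 (r / 2) ⟩
  r / 2 * 2          ≤⟨ m/n*n≤m r 2 ⟩
  r                  ∎
  where
  open ≤-Reasoning
  regroup : h + (r / 2 ∸ 1) ≡ (h ∸ 1) + r / 2
  regroup = begin-equality
    h + (r / 2 ∸ 1)            ≡⟨ cong (_+ (r / 2 ∸ 1)) (m+[n∸m]≡n 1≤h) ⟨
    suc (h ∸ 1) + (r / 2 ∸ 1)  ≡⟨ +-suc (h ∸ 1) (r / 2 ∸ 1) ⟨
    (h ∸ 1) + suc (r / 2 ∸ 1)  ≡⟨ cong ((h ∸ 1) +_) (m+[n∸m]≡n (m≥n⇒m/n>0 {r} {2} 2≤r)) ⟩
    (h ∸ 1) + r / 2            ∎

module HeavyPair {r′ k : ℕ} (H : Multigraph (suc (suc r′)))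
  (w≥1 : ∀ a b → a ≢ b → 1 ≤ Multigraph.w H a b)
  (h′ s : ℕ) (edges≡ : edges H ≡ suc h′) (k≡ : h′ + s ≡ k) (2s≤r : 2 * s ≤ suc (suc r′)) where

  r : ℕ
  r = suc (suc r′)

  -- Any Q > r h′ would do: it keeps the total degree deficit j h′ (n − 1) / Q of the
  -- j ≤ r vertices placed so far below n, which is what averaging needs.
  Q : ℕ
  Q = suc (r * h′)

  multicolouredCopy : ∀ {n′} (G : SimplyColored (suc n′) k) →
    (∀ v → Q * (h′ * n′) ≤ Q * deg G v + h′ * n′) →
    Q * (r * h′ + (r * k + 1) * r) < suc n′ →
    ∀ u v → u ≢ v → h′ < wG G u v → MulticoloredCopy H G
  multicolouredCopy G deg≥ big u v u≢v heavy = record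
    { φ       = φ
    ; φ-inj   = λ {a} {b} → injective a b (Finₚ.toℕ<n a) (Finₚ.toℕ<n b)
    ; col     = colour
    ; col-ok  = λ a b t a<b t<w → allowed a b t (on-pair a<b t<w)
    ; col-inj = λ a b t a′ b′ t′ a<b t<w a′<b′ t′<w′ →
                  colouring-injective a b t a′ b′ t′ (on-pair a<b t<w) (on-pair a′<b′ t′<w′)
    }
    where
    open GreedyEmbedding G h′ Q deg≥ ≤-refl big u v u≢v heavy using (PartialEmbedding; embedding; weights)
    open PartialEmbedding embedding

    weights≤ : ∀ a b → weights φ a b ≤ h′ + s
    weights≤ a b = subst (weights φ a b ≤_) (sym k≡) (count≤ _)

    backDegree≥-all : ∀ b → h′ * toℕ b ≤ backDegree (weights φ) b
    backDegree≥-all b = backDegree≥ b (Finₚ.toℕ<n b)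

    backDegree₁> : h′ * 1 < backDegree (weights φ) (suc zero)
    backDegree₁> = subst (_< backDegree (weights φ) (suc zero)) (sym (*-identityʳ h′)) backDegree₁

    open ShortPairs (weights φ) h′ s weights≤ 2s≤r backDegree≥-all (suc zero) backDegree₁>
      using (few-short-copies)

    C : Fin r → Fin r → Fin k → Bool
    C a b c = SimplyColored.adj G c (φ a) (φ b)

    c₀ : Fin k
    c₀ = Fin.fromℕ< (≤-trans (s≤s z≤n) (≤-trans heavy (count≤ _)))

    open ListEdgeColouring C c₀ using (shortDemand; colouring; module Colouring)

    demand : Fin r → Fin r → ℕ
    demand = onPairs (Multigraph.w H)

    few : ∀ t → shortDemand demand t ≤ t
    few = few-short-copies (Multigraph.w H) (λ a b a<b → w≥1 a b (λ a≡b → <-irrefl (cong toℕ a≡b) a<b))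
                           edges≡

    open Colouring (colouring demand few) renaming (injective to colouring-injective)

    on-pair : ∀ {a b t} → toℕ a < toℕ b → t < Multigraph.w H a b → t < demand a b
    on-pair {a} {b} {t} a<b t<w = subst (t <_) (sym (onPairs-< (Multigraph.w H) a<b)) t<w

lemmaB1 : (r : ℕ) → 3 ≤ r → (H : Multigraph r) →
          (∀ u v → u ≢ v → 1 ≤ Multigraph.w H u v) →
          (k : ℕ) → edges H ≤ k → k ≤ edges H + (r / 2 ∸ 1) →
          Σ ℚ (λ δ₀ → (0ℚ ℚ.< δ₀) ×
            ((δ : ℚ) → 0ℚ ℚ.< δ → δ ℚ.≤ δ₀ →
              Σ ℕ (λ n₀ → (n : ℕ) → n₀ ≤ n → (G : SimplyColored n k) →
                ¬ MulticoloredCopy H G →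
                (∀ v → (1ℚ ℚ.- δ) ℚ.* ℕ→ℚ ((edges H ∸ 1) * (n ∸ 1)) ℚ.≤ ℕ→ℚ (deg G v)) →
                ∀ u v → u ≢ v → wG G u v ≤ edges H ∸ 1)))
lemmaB1 r@(suc (suc r′)) (s≤s (s≤s _)) H w≥1 k edges≤k k≤ =
  1/suc (r * h′) , 1/suc-pos (r * h′) , λ δ _ δ≤δ₀ → suc (Q * (r * h′ + (r * k + 1) * r)) , λ where
    zero ()
    (suc n′) big G no-copy degree u v u≢v → ≮⇒≥ λ heavy →
      no-copy (multicolouredCopy G (λ x → degree-bound (r * h′) (h′ * n′) (deg G x) δ≤δ₀ (degree x))
                                 big u v u≢v heavy)
  where
  h′ : ℕ
  h′ = edges H ∸ 1

  edges≥1 : 1 ≤ edges H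
  edges≥1 = ≤-trans (w≥1 zero (suc zero) (λ ())) (term≤∑∑ (onPairs (Multigraph.w H)) zero (suc zero))

  edges≡ : edges H ≡ suc h′
  edges≡ = sym (m+[n∸m]≡n edges≥1)

  k≡ : h′ + (k ∸ h′) ≡ k
  k≡ = m+[n∸m]≡n (≤-trans (m∸n≤m (edges H) 1) edges≤k)

  open HeavyPair H w≥1 h′ (k ∸ h′) edges≡ k≡ (surplus-bound (s≤s (s≤s z≤n)) edges≥1 k≤)
    using (Q; multicolouredCopy)
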